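{- Let $S$ be a finite set and let $G$ be the equivalent metrics graph on $L$, the set of linear orders on $\binom{S}{2}$. An edge of $G$ joining $\preccurlyeq$ and $\preccurlyeq'$ is white (i.e. $\varphi(\preccurlyeq)=\varphi(\preccurlyeq')$) if and only if the two consecutive items $xy$ and $zw$ that are swapped between $\preccurlyeq$ and $\preccurlyeq'$ are disjoint, i.e. $\{x,y\}\cap\{z,w\}=\varnothing$.
   Context: A ranking system on a finite set $S$ is a family $(r_x)_{x\in S}$ where each $r_x:S\setminus\{x\}\to\{1,\dots,|S|-1\}$ is a bijection. Write $xy$ for $\{x,y\}$ and $\binom{S}{2}$ for the set of 2-subsets of $S$. For a linear order $\preccurlyeq$ on $\binom{S}{2}$, $\varphi(\preccurlyeq)$ is the ranking system on $S$ defined by $r_x(y)=|\{z\in S\setminus\{x\}: xz\preccurlyeq xy\}|$ for distinct $x,y\in S$. The equivalent metrics graph $G$ has vertex set the set of all linear orders on $\binom{S}{2}$, with $\preccurlyeq$ and $\preccurlyeq'$ adjacent iff $\preccurlyeq'$ is obtained from $\preccurlyeq$ by swapping the order of two items that are consecutive in $\preccurlyeq$ (the two 2-sets may intersect). An edge of $G$ between $\preccurlyeq$ and $\preccurlyeq'$ is colored white if $\varphi(\preccurlyeq)=\varphi(\preccurlyeq')$ and black otherwise. -}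

module Defs where

open import Data.Nat using (ℕ; zero; suc)
open import Data.Fin using (Fin; _<_)
open import Data.Fin.Properties using (<-cmp)
open import Data.List using (List; map)
open import Data.Nat.ListAction using (sum)
open import Data.List.Base using (allFin)
open import Data.Product using (_×_; _,_)
open import Data.Sum using (_⊎_)
open import Data.Empty using (⊥-elim)
open import Relation.Nullary using (¬_; Dec; yes; no)
open import Relation.Binary using (Tri; tri<; tri≈; tri>)
open import Relation.Binary.PropositionalEquality using (_≡_; _≢_; refl; sym)
open import Function.Bundles using (_⇔_)

-- The finite set S is Fin n.
-- A 2-subset {x , y} of Fin n, stored as lo < hi.
record Pair (n : ℕ) : Set where
  constructor ⟨_,_,_⟩
  field
    lo hi : Fin n
    lo<hi : lo < hi
open Pair public

_∈₂_ : {n : ℕ} → Fin n → Pair n → Set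
x ∈₂ p = (x ≡ lo p) ⊎ (x ≡ hi p)

Disjoint₂ : {n : ℕ} → Pair n → Pair n → Set
Disjoint₂ p q = ∀ x → x ∈₂ p → ¬ (x ∈₂ q)

edge : {n : ℕ} (x z : Fin n) → x ≢ z → Pair n
edge x z x≢z with <-cmp x z
... | tri< lt _ _ = ⟨ x , z , lt ⟩
... | tri≈ _ eq _ = ⊥-elim (x≢z eq)
... | tri> _ _ gt = ⟨ z , x , gt ⟩

record LinOrder (n : ℕ) : Set₁ where
  field
    _≼_     : Pair n → Pair n → Set
    ≼-dec   : ∀ p q → Dec (p ≼ q)
    ≼-refl  : ∀ p → p ≼ p
    ≼-antisym : ∀ p q → p ≼ q → q ≼ p → p ≡ q
    ≼-trans : ∀ p q r → p ≼ q → q ≼ r → p ≼ r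
    ≼-total : ∀ p q → (p ≼ q) ⊎ (q ≼ p)
open LinOrder public

RankingSystem : ℕ → Set
RankingSystem n = (x y : Fin n) → x ≢ y → ℕ

_≈R_ : {n : ℕ} → RankingSystem n → RankingSystem n → Set
r ≈R r' = ∀ x y (x≢y : x ≢ y) → r x y x≢y ≡ r' x y x≢y

private
  ind : {n : ℕ} → LinOrder n → (x y : Fin n) → x ≢ y → Fin n → ℕ
  ind {n} O x y x≢y z with z Data.Fin.≟ x
  ... | yes _ = 0
  ... | no z≢x with ≼-dec O (edge x z (λ e → z≢x (sym e))) (edge x y x≢y)
  ...   | yes _ = 1
  ...   | no _ = 0

-- φ(≼): r_x(y) = |{ z ∈ S ∖ {x} : xz ≼ xy }|
φ : {n : ℕ} → LinOrder n → RankingSystem n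
φ {n} O x y x≢y = sum (map (ind O x y x≢y) (allFin n))

-- O' is obtained from O by swapping the two O-consecutive items a ≺ b.
SwapConsecutive : {n : ℕ} → LinOrder n → LinOrder n → Pair n → Pair n → Set
SwapConsecutive O O' a b =
  (a ≢ b) × (_≼_ O a b)
  × (∀ c → _≼_ O a c → _≼_ O c b → (c ≡ a) ⊎ (c ≡ b))
  × (_≼_ O' b a)
  × (∀ p q → ¬ ((p ≡ a) × (q ≡ b)) → ¬ ((p ≡ b) × (q ≡ a))
        → (_≼_ O p q ⇔ _≼_ O' p q))

White : {n : ℕ} → LinOrder n → LinOrder n → Set
White O O' = φ O ≈R φ O'

-- Swapping a and b changes only the comparison between a and b, and r_x only
-- compares pairs through x. So r_x is unchanged unless x ∈ a ∩ b; in that case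
-- a = xy and b = xw, and r_x(y) gains exactly the summand for w.
module Submission where

open import Defs
open import Data.Nat using (ℕ; _≤_; _<_; z≤n; s≤s)
open import Data.Nat.Properties using (≤-refl; ≤-antisym; <-irrefl; +-mono-≤; +-mono-<-≤; +-mono-≤-<)
open import Data.Nat.ListAction using (sum)
open import Data.Fin using (Fin; _≟_)
open import Data.Fin.Properties using (<-cmp; <-irrelevant)
  renaming (<-irrefl to <ᶠ-irrefl)
open import Data.List using (List; []; _∷_; map; allFin)
open import Data.List.Relation.Unary.Any using (here; there)
open import Data.List.Membership.Propositional using (_∈_)
open import Data.List.Membership.Propositional.Properties using (∈-allFin)
open import Data.Product using (Σ; ∃₂; proj₁; proj₂; _,_; _×_)
open import Data.Sum using (inj₁; inj₂)
open import Data.Empty using (⊥-elim)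
open import Function.Bundles using (_⇔_; mk⇔; Equivalence)
open import Relation.Nullary using (¬_; yes; no)
open import Relation.Binary using (tri<; tri≈; tri>)
open import Relation.Binary.PropositionalEquality using (_≡_; _≢_; refl; sym; trans; cong; subst; subst₂)

sum-map-mono : {A : Set} {f g : A → ℕ} → (∀ z → f z ≤ g z) → (xs : List A) → sum (map f xs) ≤ sum (map g xs)
sum-map-mono f≤g []       = z≤n
sum-map-mono f≤g (x ∷ xs) = +-mono-≤ (f≤g x) (sum-map-mono f≤g xs)

sum-map-mono-< : {A : Set} {f g : A → ℕ} → (∀ z → f z ≤ g z) → ∀ {w xs} → w ∈ xs → f w < g w
  → sum (map f xs) < sum (map g xs)
sum-map-mono-< f≤g {xs = _ ∷ xs} (here refl) fw<gw = +-mono-<-≤ fw<gw (sum-map-mono f≤g xs)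
sum-map-mono-< f≤g {xs = x ∷ _}  (there w∈xs) fw<gw = +-mono-≤-< (f≤g x) (sum-map-mono-< f≤g w∈xs fw<gw)

module _ {n : ℕ} where

  edge-irrelevant : (x z : Fin n) (h h' : x ≢ z) → edge x z h ≡ edge x z h'
  edge-irrelevant x z h h' with <-cmp x z
  ... | tri< _ _ _  = refl
  ... | tri≈ _ eq _ = ⊥-elim (h eq)
  ... | tri> _ _ _  = refl

  ∈₂-edge : (x z : Fin n) (h : x ≢ z) → x ∈₂ edge x z h
  ∈₂-edge x z h with <-cmp x z
  ... | tri< _ _ _  = inj₁ refl
  ... | tri≈ _ eq _ = ⊥-elim (h eq)
  ... | tri> _ _ _  = inj₂ refl

  ∈₂⇒edge : (p : Pair n) (x : Fin n) → x ∈₂ p → ∃₂ λ y (x≢y : x ≢ y) → edge x y x≢y ≡ p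
  ∈₂⇒edge ⟨ l , u , l<u ⟩ .l (inj₁ refl) = u , l≢u , edge-lu
    where
    l≢u : l ≢ u
    l≢u l≡u = <ᶠ-irrefl l≡u l<u
    edge-lu : edge l u l≢u ≡ ⟨ l , u , l<u ⟩
    edge-lu with <-cmp l u
    ... | tri< l<u' _ _ = cong (λ lt → ⟨ l , u , lt ⟩) (<-irrelevant l<u' l<u)
    ... | tri≈ l≮u _ _  = ⊥-elim (l≮u l<u)
    ... | tri> l≮u _ _  = ⊥-elim (l≮u l<u)
  ∈₂⇒edge ⟨ l , u , l<u ⟩ .u (inj₂ refl) = l , u≢l , edge-ul
    where
    u≢l : u ≢ l
    u≢l u≡l = <ᶠ-irrefl (sym u≡l) l<u
    edge-ul : edge u l u≢l ≡ ⟨ l , u , l<u ⟩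
    edge-ul with <-cmp u l
    ... | tri> _ _ l<u' = cong (λ lt → ⟨ l , u , lt ⟩) (<-irrelevant l<u' l<u)
    ... | tri≈ _ _ l≮u  = ⊥-elim (l≮u l<u)
    ... | tri< _ _ l≮u  = ⊥-elim (l≮u l<u)

  -- The summand of φ is private to Defs; it is recovered here by unification.
  φ-as-sum : (O : LinOrder n) (x y : Fin n) (x≢y : x ≢ y)
    → Σ (Fin n → ℕ) λ f → φ O x y x≢y ≡ sum (map f (allFin n))
  φ-as-sum O x y x≢y = _ , refl

  rank-summand : LinOrder n → (x y : Fin n) → x ≢ y → Fin n → ℕ
  rank-summand O x y x≢y = proj₁ (φ-as-sum O x y x≢y)

  EdgeBelow : LinOrder n → (x y : Fin n) → x ≢ y → (z : Fin n) → x ≢ z → Set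
  EdgeBelow P x y x≢y z x≢z = _≼_ P (edge x z x≢z) (edge x y x≢y)

  module _ (O O' : LinOrder n) (x y : Fin n) (x≢y : x ≢ y) where

    private
      Below Below' : (z : Fin n) → x ≢ z → Set
      Below  = EdgeBelow O x y x≢y
      Below' = EdgeBelow O' x y x≢y

    rank-summand-mono : (∀ z x≢z → Below z x≢z → Below' z x≢z)
      → ∀ z → rank-summand O x y x≢y z ≤ rank-summand O' x y x≢y z
    rank-summand-mono below⇒below' z with z ≟ x
    ... | yes _ = z≤n
    ... | no z≢x with ≼-dec O (edge x z (λ e → z≢x (sym e))) (edge x y x≢y)
                    | ≼-dec O' (edge x z (λ e → z≢x (sym e))) (edge x y x≢y)
    ...   | yes _     | yes _       = ≤-refl
    ...   | no _      | _           = z≤n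
    ...   | yes below | no ¬below'  = ⊥-elim (¬below' (below⇒below' z _ below))

    rank-summand-< : (w : Fin n) (x≢w : x ≢ w) → ¬ Below w x≢w → Below' w x≢w
      → rank-summand O x y x≢y w < rank-summand O' x y x≢y w
    rank-summand-< w x≢w ¬below below' with w ≟ x
    ... | yes w≡x = ⊥-elim (x≢w (sym w≡x))
    ... | no w≢x with ≼-dec O (edge x w (λ e → w≢x (sym e))) (edge x y x≢y)
                    | ≼-dec O' (edge x w (λ e → w≢x (sym e))) (edge x y x≢y)
    ...   | no _      | yes _      = s≤s z≤n
    ...   | yes below | _          = ⊥-elim (¬below (subst (λ p → _≼_ O p (edge x y x≢y))
                                                           (edge-irrelevant x w _ x≢w) below))
    ...   | no _      | no ¬below' = ⊥-elim (¬below' (subst (λ p → _≼_ O' p (edge x y x≢y))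
                                                            (edge-irrelevant x w x≢w _) below'))

    φ-mono : (∀ z x≢z → Below z x≢z → Below' z x≢z) → φ O x y x≢y ≤ φ O' x y x≢y
    φ-mono below⇒below' = sum-map-mono (rank-summand-mono below⇒below') (allFin n)

    φ-mono-< : (∀ z x≢z → Below z x≢z → Below' z x≢z)
      → (w : Fin n) (x≢w : x ≢ w) → ¬ Below w x≢w → Below' w x≢w
      → φ O x y x≢y < φ O' x y x≢y
    φ-mono-< below⇒below' w x≢w ¬below below' =
      sum-map-mono-< (rank-summand-mono below⇒below') (∈-allFin w) (rank-summand-< w x≢w ¬below below')

  φ-cong : (O O' : LinOrder n) (x y : Fin n) (x≢y : x ≢ y)
    → (∀ z x≢z → EdgeBelow O x y x≢y z x≢z ⇔ EdgeBelow O' x y x≢y z x≢z)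
    → φ O x y x≢y ≡ φ O' x y x≢y
  φ-cong O O' x y x≢y below⇔below' = ≤-antisym
    (φ-mono O O' x y x≢y (λ z x≢z → Equivalence.to (below⇔below' z x≢z)))
    (φ-mono O' O x y x≢y (λ z x≢z → Equivalence.from (below⇔below' z x≢z)))

  module _ {O O' : LinOrder n} {a b : Pair n} (swap : SwapConsecutive O O' a b) where

    private
      a≢b : a ≢ b
      a≢b = proj₁ swap
      a≼b : _≼_ O a b
      a≼b = proj₁ (proj₂ swap)
      b≼'a : _≼_ O' b a
      b≼'a = proj₁ (proj₂ (proj₂ (proj₂ swap)))

    swap-preserves : ∀ p q → ¬ (p ≡ a × q ≡ b) → ¬ (p ≡ b × q ≡ a) → _≼_ O p q ⇔ _≼_ O' p q
    swap-preserves = proj₂ (proj₂ (proj₂ (proj₂ swap)))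

    swap-mono : ∀ p q → ¬ (p ≡ a × q ≡ b) → _≼_ O p q → _≼_ O' p q
    swap-mono p q ¬ab p≼q with ≼-dec O' p q
    ... | yes p≼'q = p≼'q
    ... | no p⋠'q  = ⊥-elim (p⋠'q (Equivalence.to (swap-preserves p q ¬ab ¬ba) p≼q))
      where
      ¬ba : ¬ (p ≡ b × q ≡ a)
      ¬ba (p≡b , q≡a) = p⋠'q (subst₂ (_≼_ O') (sym p≡b) (sym q≡a) b≼'a)

    φ-swap-unchanged : (x y : Fin n) (x≢y : x ≢ y) → ¬ (x ∈₂ a × x ∈₂ b) → φ O x y x≢y ≡ φ O' x y x≢y
    φ-swap-unchanged x y x≢y x∉a∩b = φ-cong O O' x y x≢y λ z x≢z →
      swap-preserves _ _ (not-ab (∈₂-edge x z x≢z) (∈₂-edge x y x≢y))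
                         (λ (xz≡b , xy≡a) → not-ab (∈₂-edge x y x≢y) (∈₂-edge x z x≢z) (xy≡a , xz≡b))
      where
      not-ab : ∀ {p q} → x ∈₂ p → x ∈₂ q → ¬ (p ≡ a × q ≡ b)
      not-ab x∈p x∈q (p≡a , q≡b) = x∉a∩b (subst (x ∈₂_) p≡a x∈p , subst (x ∈₂_) q≡b x∈q)

    φ-swap-increases : (x y w : Fin n) (x≢y : x ≢ y) (x≢w : x ≢ w)
      → edge x y x≢y ≡ a → edge x w x≢w ≡ b → φ O x y x≢y < φ O' x y x≢y
    φ-swap-increases x y w x≢y x≢w xy≡a xw≡b =
      φ-mono-< O O' x y x≢y below⇒below' w x≢w ¬b≼a b≼'a'
      where
      below⇒below' : ∀ z x≢z → EdgeBelow O x y x≢y z x≢z → EdgeBelow O' x y x≢y z x≢z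
      below⇒below' z x≢z = swap-mono _ _ λ (_ , xy≡b) → a≢b (trans (sym xy≡a) xy≡b)
      ¬b≼a : ¬ EdgeBelow O x y x≢y w x≢w
      ¬b≼a b≼a = a≢b (≼-antisym O a b a≼b (subst₂ (_≼_ O) xw≡b xy≡a b≼a))
      b≼'a' : EdgeBelow O' x y x≢y w x≢w
      b≼'a' = subst₂ (_≼_ O') (sym xw≡b) (sym xy≡a) b≼'a

proposition5p10 : (n : ℕ) (O O' : LinOrder n) (a b : Pair n)
    → SwapConsecutive O O' a b
    → (White O O' ⇔ Disjoint₂ a b)
proposition5p10 n O O' a b swap = mk⇔ white⇒disjoint disjoint⇒white
  where
  white⇒disjoint : White O O' → Disjoint₂ a b
  white⇒disjoint white x x∈a x∈b with ∈₂⇒edge a x x∈a | ∈₂⇒edge b x x∈b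
  ... | y , x≢y , xy≡a | w , x≢w , xw≡b =
    <-irrefl (white x y x≢y) (φ-swap-increases swap x y w x≢y x≢w xy≡a xw≡b)

  disjoint⇒white : Disjoint₂ a b → White O O'
  disjoint⇒white disjoint x y x≢y =
    φ-swap-unchanged swap x y x≢y λ (x∈a , x∈b) → disjoint x x∈a x∈b
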